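{- Let $D$ be a minimal strong digraph, let $C_q$ be a directed cycle of length $q\ge 2$ contained in $D$, let $D'$ be the digraph obtained from $D$ by deleting all arcs of $C_q$, and let $H$ be the digraph obtained from $D'$ by contracting each strong component of $D'$ to a single vertex. Then the number of linear vertices of $H$ is greater than or equal to the number of pseudominimal vertices of $H$, and also greater than or equal to the number of pseudomaximal vertices of $H$.
   Context: An arc $uv$ of a digraph is transitive if there is another directed $uv$-path not using the arc $uv$. A minimal strong digraph is a strongly connected digraph with no transitive arcs. A strong component (SC) is a maximal strongly connected subdigraph. The digraph $H$ (called the Hasse diagram associated to $(D,C_q)$) has one vertex per SC of $D'$ and an arc from the vertex of $S_1$ to the vertex of $S_2$ whenever $D'$ has an arc from a vertex of $S_1$ to a vertex of $S_2$ ($S_1\ne S_2$); it is acyclic without transitive arcs. A strong component of $D'$ is anchored if it contains at least one vertex of $C_q$. A vertex of $H$ is pseudominimal if it corresponds to an anchored SC and has outdegree greater than $0$ in $H$; it is pseudomaximal if it corresponds to an anchored SC and has indegree greater than $0$ in $H$. A vertex of $H$ is linear if its indegree and outdegree in $H$ are both $1$. -}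

module Defs where

open import Data.Nat using (ℕ; zero; suc; _<?_)
open import Data.Fin using (Fin; zero; suc; toℕ; fromℕ<)
open import Data.Product using (Σ; ∃; _×_; _,_)
open import Relation.Nullary using (¬_; yes; no)
open import Relation.Binary.PropositionalEquality using (_≡_)

Digraph : ℕ → Set₁
Digraph n = Fin n → Fin n → Set

data Reach {n : ℕ} (A : Digraph n) : Fin n → Fin n → Set where
  here : ∀ {x} → Reach A x x
  step : ∀ {x y z} → A x y → Reach A y z → Reach A x z

Loopless : ∀ {n} → Digraph n → Set
Loopless A = ∀ x → ¬ A x x

StronglyConnected : ∀ {n} → Digraph n → Set
StronglyConnected A = ∀ u v → Reach A u v

deleteArc : ∀ {n} → Digraph n → Fin n → Fin n → Digraph n
deleteArc A u v x y = A x y × ¬ (x ≡ u × y ≡ v)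

TransitiveArc : ∀ {n} → Digraph n → Fin n → Fin n → Set
TransitiveArc A u v = A u v × Reach (deleteArc A u v) u v

MinimalStrong : ∀ {n} → Digraph n → Set
MinimalStrong A = StronglyConnected A × (∀ u v → ¬ TransitiveArc A u v)

cycNext : (q : ℕ) → Fin q → Fin q
cycNext (suc m) i with suc (toℕ i) <? suc m
... | yes p = fromℕ< p
... | no _ = zero

-- c : Fin q → Fin n lists the vertices of a directed cycle c0 → c1 → ... → c(q-1) → c0
IsCycle : ∀ {n} → Digraph n → (q : ℕ) → (Fin q → Fin n) → Set
IsCycle A q c = (∀ i j → c i ≡ c j → i ≡ j) × (∀ i → A (c i) (c (cycNext q i)))

CycleArc : ∀ {n} (q : ℕ) → (Fin q → Fin n) → Fin n → Fin n → Set
CycleArc q c x y = ∃ λ i → x ≡ c i × y ≡ c (cycNext q i)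

deleteCycle : ∀ {n} → Digraph n → (q : ℕ) → (Fin q → Fin n) → Digraph n
deleteCycle A q c x y = A x y × ¬ CycleArc q c x y

SameSC : ∀ {n} → Digraph n → Fin n → Fin n → Set
SameSC A x y = Reach A x y × Reach A y x

-- The classes of E meeting P number exactly k: r picks one representative
-- satisfying P per class, distinct classes, and every P-vertex is in some class.
NumClasses : ∀ {n} → (Fin n → Fin n → Set) → (Fin n → Set) → ℕ → Set
NumClasses {n} E P k =
  Σ (Fin k → Fin n) λ r →
    (∀ i → P (r i)) × (∀ i j → E (r i) (r j) → i ≡ j) × (∀ x → P x → ∃ λ i → E x (r i))

-- Arc of the Hasse diagram H from the SC of x to the SC of y.
HArc : ∀ {n} → Digraph n → Fin n → Fin n → Set
HArc A x y = ¬ SameSC A x y ×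
  ∃ λ x' → ∃ λ y' → SameSC A x x' × SameSC A y y' × A x' y'

OutDeg : ∀ {n} → Digraph n → Fin n → ℕ → Set
OutDeg A x k = NumClasses (SameSC A) (HArc A x) k

InDeg : ∀ {n} → Digraph n → Fin n → ℕ → Set
InDeg A x k = NumClasses (SameSC A) (λ y → HArc A y x) k

Anchored : ∀ {n} → Digraph n → (q : ℕ) → (Fin q → Fin n) → Fin n → Set
Anchored A q c x = ∃ λ i → SameSC A x (c i)

Linear : ∀ {n} → Digraph n → Fin n → Set
Linear A x = InDeg A x 1 × OutDeg A x 1

PseudoMinimal : ∀ {n} → Digraph n → (q : ℕ) → (Fin q → Fin n) → Fin n → Set
PseudoMinimal A q c x = Anchored A q c x × ∃ λ y → HArc A x y

PseudoMaximal : ∀ {n} → Digraph n → (q : ℕ) → (Fin q → Fin n) → Fin n → Set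
PseudoMaximal A q c x = Anchored A q c x × ∃ λ y → HArc A y x

{-# OPTIONS --safe #-}

-- Call a vertex set Y admissible if it is a union of strong components of D′, contains the
-- cycle, and induces a strongly connected subdigraph of D. If an admissible Y misses a vertex,
-- some arc y₁p₁ of D leaves Y; a path from p₁ back to Y leaves the component P of p₁ for the
-- last time along an arc ab and then first meets Y at y₂. Adding this ear to Y (the component P
-- and the components met between b and y₂) gives a strictly larger admissible set. If that set
-- is everything, the only neighbours of P in H are the components of y₁ and of b, since any
-- other arc of D′ into or out of P would make y₁p₁ or ab transitive; so P is linear. By
-- induction, every admissible set that is not everything misses a linear component.
--
-- A pseudominimal component has an arc xy of D′ leaving it, with x anchored. The vertices
-- reachable from a fixed cycle vertex in D − xy form an admissible set missing y, and for two
-- different such arcs these two sets cover all vertices (the arc deleted from one digraph is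
-- present in the other), so the linear components found outside them are distinct.
-- Pseudomaximal components are pseudominimal in the reversed digraph.
--
-- Reachability along an arbitrary arc relation is not decidable, so the argument runs in the
-- double-negation monad; the conclusion, an inequality of natural numbers, is decidable.

module Submission where

open import Defs
open import Level using (0ℓ)
open import Data.Nat using (ℕ; zero; suc; _≤_; _<_; _≤?_; _<?_; s≤s)
open import Data.Nat.Properties using (n≮n)
open import Data.Fin using (Fin; zero; suc; toℕ; fromℕ; inject₁)
open import Data.Fin.Properties
  using (_≟_; toℕ-injective; toℕ-fromℕ<; toℕ-fromℕ; toℕ-inject₁; toℕ<n; injective⇒≤; all?; ¬∀⟶∃¬; ∀-cons)
open import Data.Fin.Induction using (<-weakInduction; >-weakInduction)
open import Data.Fin.Subset using (Subset; _⊃_; _∈_)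
open import Data.Fin.Subset.Induction using (⊃-wellFounded)
open import Data.Vec using (tabulate)
open import Data.Vec.Properties using (lookup∘tabulate; []=⇒lookup; lookup⇒[]=)
open import Data.Product using (Σ; ∃; ∃₂; _×_; _,_; proj₁; proj₂; swap)
open import Data.Sum using (_⊎_; inj₁; inj₂)
import Data.Sum as Sum
open import Effect.Monad using (RawMonad)
open import Function using (_∘_; id; flip; case_of_)
open import Induction.WellFounded using (Acc; acc)
open import Relation.Binary.Core using (_⇒_)
import Relation.Binary.Definitions as Binary
open import Relation.Binary.PropositionalEquality using (_≡_; refl; sym; trans; cong; subst)
open import Relation.Nullary using (¬_; yes; no; does; contradiction)
open import Relation.Nullary.Decidable using (decidable-stable; dec-true; ¬¬-excluded-middle; _×-dec_)
open import Relation.Nullary.Negation using (¬¬-Monad)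
open import Relation.Unary using (Pred; Decidable; ∁; _∪_; _⊆_)

open RawMonad (¬¬-Monad {0ℓ}) using (pure; _>>=_)

private
  variable
    n : ℕ
    A B : Digraph n
    Y Q : Pred (Fin n) 0ℓ
    r s t u v w x y z : Fin n

infixr 5 _◅◅_

_◅◅_ : Reach A x y → Reach A y z → Reach A x z
here ◅◅ τ = τ
step a σ ◅◅ τ = step a (σ ◅◅ τ)

arc : A x y → Reach A x y
arc a = step a here

gmap : ∀ {k} {A : Digraph k} {x y} (f : Fin k → Fin n) → (∀ {x y} → A x y → B (f x) (f y)) →
  Reach A x y → Reach B (f x) (f y)
gmap f g here = here
gmap f g (step a σ) = step (g a) (gmap f g σ)

map : A ⇒ B → Reach A ⇒ Reach B
map f = gmap id f

reverse : Reach A x y → Reach (flip A) y x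
reverse here = here
reverse (step a σ) = reverse σ ◅◅ arc a

Between : Digraph n → Fin n → Fin n → Digraph n
Between A x z s t = A s t × Reach A x s × Reach A t z

between : Reach A x z → Reach (Between A x z) x z
between = go here
  where
  go : Reach A x y → Reach A y z → Reach (Between A x z) y z
  go xy here = here
  go xy (step a σ) = step (a , xy , σ) (go (xy ◅◅ arc a) σ)

TailOutside : Digraph n → Pred (Fin n) 0ℓ → Digraph n
TailOutside A Q s t = A s t × ¬ Q s

Induced : Digraph n → Pred (Fin n) 0ℓ → Digraph n
Induced A Q s t = A s t × Q s × Q t

first-entry : Decidable Q → Reach A u z → Q z → ∃ λ y → Q y × Reach (TailOutside A Q) u y
first-entry {u = u} Q? σ qz with Q? u
first-entry Q? σ qz | yes qu = _ , qu , here
first-entry Q? here qz | no ¬qu = contradiction qz ¬qu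
first-entry Q? (step a σ) qz | no ¬qu with first-entry Q? σ qz
... | y , qy , τ = y , qy , step (a , ¬qu) τ

outside-source : Reach (TailOutside A Q) v z → ¬ Q z → ¬ Q v
outside-source here ¬qz = ¬qz
outside-source (step (_ , ¬qv) _) _ = ¬qv

LastExit : Digraph n → Pred (Fin n) 0ℓ → Fin n → Set
LastExit A Q z = ∃₂ λ a b → Q a × ¬ Q b × A a b × Reach (TailOutside A Q) b z

avoids-or-exits : Decidable Q → Reach A v z → ¬ Q z → Reach (TailOutside A Q) v z ⊎ LastExit A Q z
avoids-or-exits Q? here ¬qz = inj₁ here
avoids-or-exits Q? (step {x = v} a σ) ¬qz with avoids-or-exits Q? σ ¬qz | Q? v
... | inj₂ exit | _ = inj₂ exit
... | inj₁ τ | no ¬qv = inj₁ (step (a , ¬qv) τ)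
... | inj₁ τ | yes qv = inj₂ (_ , _ , qv , outside-source τ ¬qz , a , τ)

last-exit : Decidable Q → Reach A u z → Q u → ¬ Q z → LastExit A Q z
last-exit Q? σ qu ¬qz with avoids-or-exits Q? σ ¬qz
... | inj₁ τ = contradiction qu (outside-source τ ¬qz)
... | inj₂ exit = exit

avoiding : A ⇒ B → (∀ {s t} → A s t → ¬ (s ≡ x × t ≡ y)) → Reach A ⇒ Reach (deleteArc B x y)
avoiding f g = map λ a → f a , g a

SameSC-refl : SameSC A x x
SameSC-refl = here , here

SameSC-sym : SameSC A x y → SameSC A y x
SameSC-sym (xy , yx) = yx , xy

SameSC-trans : SameSC A x y → SameSC A y z → SameSC A x z
SameSC-trans (xy , yx) (yz , zy) = xy ◅◅ yz , zy ◅◅ yx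

≁-respʳ : ¬ SameSC A x y → SameSC A y z → ¬ SameSC A x z
≁-respʳ x≁y y~z x~z = x≁y (SameSC-trans x~z (SameSC-sym y~z))

InSC : Digraph n → Fin n → Digraph n
InSC A u s t = A s t × SameSC A s u × SameSC A t u

walk-in-SC : SameSC A u v → Reach (InSC A u) u v
walk-in-SC {A = A} {u = u} {v = v} (uv , vu) = map in-SC (between uv)
  where
  in-SC : Between A u v ⇒ InSC A u
  in-SC (a , us , tv) = a , (step a (tv ◅◅ vu) , us) , (tv ◅◅ vu , us ◅◅ arc a)

walk-in-SC-avoiding : A ⇒ B → ¬ SameSC A x y → SameSC A u v → Reach (deleteArc B x y) u v
walk-in-SC-avoiding f x≁y u~v = avoiding (f ∘ proj₁)
  (λ { (_ , s~u , t~u) (refl , refl) → x≁y (SameSC-trans s~u (SameSC-sym t~u)) })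
  (walk-in-SC u~v)

Closed : Digraph n → Pred (Fin n) 0ℓ → Set
Closed A Y = ∀ {u v} → Y u → SameSC A u v → Y v

walk-in-closed : A ⇒ B → Closed A Y → Y u → SameSC A u v → Reach (Induced B Y) u v
walk-in-closed f closed yu u~v =
  map (λ { (a , s~u , t~u) → f a , closed yu (SameSC-sym s~u) , closed yu (SameSC-sym t~u) }) (walk-in-SC u~v)

induced-mono : Y ⊆ Q → Reach (Induced A Y) ⇒ Reach (Induced A Q)
induced-mono Y⊆Q = map λ { (a , ys , yt) → a , Y⊆Q ys , Y⊆Q yt }

single-class : {E : Fin n → Fin n → Set} {r : Fin n} → Q r → (∀ {x} → Q x → E x r) → NumClasses E Q 1
single-class {r = r} qr cover = (λ _ → r) , (λ _ → qr) , (λ { zero zero _ → refl }) , λ _ qx → zero , cover qx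

NumClasses-resp : {E E′ : Fin n → Fin n → Set} {k : ℕ} → E ⇒ E′ → E′ ⇒ E → Y ⊆ Q → Q ⊆ Y →
  NumClasses E Y k → NumClasses E′ Q k
NumClasses-resp E⇒E′ E′⇒E Y⊆Q Q⊆Y (r , yr , distinct , cover) =
  r , Y⊆Q ∘ yr , (λ i j e → distinct i j (E′⇒E e)) ,
  λ x qx → proj₁ (cover x (Q⊆Y qx)) , E⇒E′ (proj₂ (cover x (Q⊆Y qx)))

¬¬-∀-Fin : ∀ {k} {P : Pred (Fin k) 0ℓ} → (∀ i → ¬ ¬ P i) → ¬ ¬ (∀ i → P i)
¬¬-∀-Fin {zero} _ = pure λ ()
¬¬-∀-Fin {suc k} h = do
  p₀ ← h zero
  ps ← ¬¬-∀-Fin (h ∘ suc)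
  pure (∀-cons p₀ ps)

¬¬-decidable : (P : Pred (Fin n) 0ℓ) → ¬ ¬ Decidable P
¬¬-decidable P = ¬¬-∀-Fin λ _ → ¬¬-excluded-middle

toSubset : {Y : Pred (Fin n) 0ℓ} → Decidable Y → Subset n
toSubset Y? = tabulate (does ∘ Y?)

∈-toSubset⁺ : (Y? : Decidable Y) → Y x → x ∈ toSubset Y?
∈-toSubset⁺ {x = x} Y? yx = lookup⇒[]= x _ (trans (lookup∘tabulate (does ∘ Y?) x) (dec-true (Y? x) yx))

∈-toSubset⁻ : (Y? : Decidable Y) → x ∈ toSubset Y? → Y x
∈-toSubset⁻ {x = x} Y? x∈ with Y? x | trans (sym (lookup∘tabulate (does ∘ Y?) x)) ([]=⇒lookup x∈)
... | yes yx | _ = yx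
... | no _ | ()

⊃-induction : (P : Pred (Fin n) 0ℓ → Set) →
  (∀ {Y} → Decidable Y → (∀ {Y′} → Decidable Y′ → Y ⊆ Y′ → ∃ (λ x → Y′ x × ¬ Y x) → P Y′) → P Y) →
  ∀ {Y} → Decidable Y → P Y
⊃-induction P rec Y? = go Y? (⊃-wellFounded (toSubset Y?))
  where
  go : ∀ {Y} (Y? : Decidable Y) → Acc _⊃_ (toSubset Y?) → P Y
  go Y? (acc larger) = rec Y? λ Y′? Y⊆Y′ (x , y′x , ¬yx) → go Y′? (larger
    ( (λ x∈ → ∈-toSubset⁺ Y′? (Y⊆Y′ (∈-toSubset⁻ Y? x∈)))
    , x , ∈-toSubset⁺ Y′? y′x , ¬yx ∘ ∈-toSubset⁻ Y?))

SameSC-flip : SameSC A x y → SameSC (flip A) x y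
SameSC-flip (xy , yx) = reverse yx , reverse xy

HArc-flip : HArc A y x → HArc (flip A) x y
HArc-flip (y≁x , y′ , x′ , y~y′ , x~x′ , a) =
  (λ x~y → y≁x (SameSC-sym (SameSC-flip x~y))) , x′ , y′ , SameSC-flip x~x′ , SameSC-flip y~y′ , a

Linear-flip : Linear A x → Linear (flip A) x
Linear-flip {A = A} {x = x} (in₁ , out₁) =
  NumClasses-resp {E = SameSC A} SameSC-flip SameSC-flip HArc-flip HArc-flip out₁ ,
  NumClasses-resp {E = SameSC A} SameSC-flip SameSC-flip HArc-flip HArc-flip in₁

MinimalStrong-flip : MinimalStrong A → MinimalStrong (flip A)
MinimalStrong-flip {A = A} (strong , no-transitive) =
  (λ u v → reverse (strong v u)) ,
  λ u v (vu , σ) → no-transitive v u (vu , map flip-arc (reverse σ))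
  where
  flip-arc : ∀ {u v} → flip (deleteArc (flip A) u v) ⇒ deleteArc A v u
  flip-arc (a , ne) = a , λ { (refl , refl) → ne (refl , refl) }

PseudoMaximal-flip : ∀ {q} {c : Fin q → Fin n} → PseudoMaximal A q c x → PseudoMinimal (flip A) q c x
PseudoMaximal-flip ((i , x~ci) , y , yx) = (i , SameSC-flip x~ci) , y , HArc-flip yx

PseudoMinimal-flip : ∀ {q} {c : Fin q → Fin n} → PseudoMinimal (flip A) q c x → PseudoMaximal A q c x
PseudoMinimal-flip ((i , x~ci) , y , xy) = (i , SameSC-flip x~ci) , y , HArc-flip xy

CycSucc : ∀ m → Digraph (suc m)
CycSucc m i j = j ≡ cycNext (suc m) i

cycNext-inject₁ : ∀ {m} (i : Fin m) → cycNext (suc m) (inject₁ i) ≡ suc i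
cycNext-inject₁ {m} i with suc (toℕ (inject₁ i)) <? suc m
... | yes p = toℕ-injective (trans (toℕ-fromℕ< p) (cong suc (toℕ-inject₁ i)))
... | no ¬p = contradiction (s≤s (subst (_< m) (sym (toℕ-inject₁ i)) (toℕ<n i))) ¬p

cycNext-fromℕ : ∀ m → cycNext (suc m) (fromℕ m) ≡ zero
cycNext-fromℕ m with suc (toℕ (fromℕ m)) <? suc m
... | yes p = contradiction (subst (λ k → suc k < suc m) (toℕ-fromℕ m) p) (n≮n (suc m))
... | no _ = refl

CycSucc-strong : ∀ m → StronglyConnected (CycSucc m)
CycSucc-strong m i j = to-last i ◅◅ arc (sym (cycNext-fromℕ m)) ◅◅ from-zero j
  where
  from-zero : ∀ j → Reach (CycSucc m) zero j
  from-zero = <-weakInduction _ here λ i σ → σ ◅◅ arc (sym (cycNext-inject₁ i))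
  to-last : ∀ i → Reach (CycSucc m) i (fromℕ m)
  to-last = >-weakInduction _ here λ i σ → step (sym (cycNext-inject₁ i)) σ

OnCycle : ∀ {k} → (Fin k → Fin n) → Pred (Fin n) 0ℓ
OnCycle c u = ∃ λ i → u ≡ c i

CycleArc⊆ : ∀ {q} {c : Fin q → Fin n} → IsCycle A q c → CycleArc q c ⇒ A
CycleArc⊆ (_ , arcs) (i , refl , refl) = arcs i

CycleArc-ends : ∀ {q} {c : Fin q → Fin n} → CycleArc q c s t → OnCycle c s × OnCycle c t
CycleArc-ends (i , refl , refl) = (i , refl) , (cycNext _ i , refl)

CycleArc-strong : ∀ {m} (c : Fin (suc m) → Fin n) i j → Reach (CycleArc (suc m) c) (c i) (c j)
CycleArc-strong {m = m} c i j = gmap c (λ {i} i→j → i , refl , cong c i→j) (CycSucc-strong m i j)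

module CycleDeletion
  {n} (D R : Digraph n) (minimal : MinimalStrong D) (R⊆D : R ⇒ D)
  {m} (c : Fin (suc m) → Fin n)
  (R-ends : ∀ {s t} → R s t → OnCycle c s × OnCycle c t)
  (R-strong : ∀ i j → Reach R (c i) (c j))
  where

  D′ : Digraph n
  D′ s t = D s t × ¬ R s t

  infix 4 _~_
  _~_ : Fin n → Fin n → Set
  _~_ = SameSC D′

  c₀ : Fin n
  c₀ = c zero

  strong : StronglyConnected D
  strong = proj₁ minimal

  no-transitive : D x y → ¬ Reach (deleteArc D x y) x y
  no-transitive xy σ = proj₂ minimal _ _ (xy , σ)

  record Admissible (Y : Pred (Fin n) 0ℓ) : Set where
    field
      closed : Closed D′ Y
      strong-in : ∀ {u v} → Y u → Y v → Reach (Induced D Y) u v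
      cycle⊆ : OnCycle c ⊆ Y

  open Admissible

  D′-from-outside : Admissible Y → D s t → ¬ Y s → D′ s t
  D′-from-outside adm st ¬ys = st , λ r → ¬ys (cycle⊆ adm (proj₁ (R-ends r)))

  D′-into-outside : Admissible Y → D s t → ¬ Y t → D′ s t
  D′-into-outside adm st ¬yt = st , λ r → ¬yt (cycle⊆ adm (proj₂ (R-ends r)))

  record Extension (Y : Pred (Fin n) 0ℓ) : Set₁ where
    field
      Y′ : Pred (Fin n) 0ℓ
      admissible : Admissible Y′
      Y⊆Y′ : Y ⊆ Y′
      new : Fin n
      new∈Y′ : Y′ new
      new∉Y : ¬ Y new
      new-linear : (∀ w → Y′ w) → Linear D′ new

  module Ear {Y} (adm : Admissible Y)
    {y₁ p₁} (y₁∈Y : Y y₁) (p₁∉Y : ¬ Y p₁) (y₁p₁ : D y₁ p₁)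
    {a b} (p₁~a : p₁ ~ a) (p₁≁b : ¬ p₁ ~ b) (ab : D a b)
    {y₂} (y₂∈Y : Y y₂) (σ : Reach (TailOutside (TailOutside D (p₁ ~_)) Y) b y₂)
    where

    P : Pred (Fin n) 0ℓ
    P = p₁ ~_

    EarArc : Digraph n
    EarArc = TailOutside (TailOutside D P) Y

    OnEar : Pred (Fin n) 0ℓ
    OnEar u = Reach EarArc b u × Reach EarArc u y₂

    Z : Pred (Fin n) 0ℓ
    Z w = ∃ λ u → OnEar u × u ~ w

    Y′ : Pred (Fin n) 0ℓ
    Y′ = Y ∪ P ∪ Z

    P⊆∁Y : P ⊆ ∁ Y
    P⊆∁Y p₁~w yw = p₁∉Y (closed adm yw (SameSC-sym p₁~w))

    y₁≁p₁ : ¬ y₁ ~ p₁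
    y₁≁p₁ y₁~p₁ = P⊆∁Y (SameSC-sym y₁~p₁) y₁∈Y

    y₁p₁′ : D′ y₁ p₁
    y₁p₁′ = D′-into-outside adm y₁p₁ p₁∉Y

    ab′ : D′ a b
    ab′ = D′-from-outside adm ab (P⊆∁Y p₁~a)

    ear⊆D′ : EarArc ⇒ D′
    ear⊆D′ ((st , _) , ¬ys) = D′-from-outside adm st ¬ys

    p₁⇝Z : Z w → Reach D′ p₁ w
    p₁⇝Z (u , (bu , _) , u~w) = proj₁ p₁~a ◅◅ step ab′ (map ear⊆D′ bu) ◅◅ proj₁ u~w

    closed′ : Closed D′ Y′
    closed′ (inj₁ yu) u~v = inj₁ (closed adm yu u~v)
    closed′ (inj₂ (inj₁ p₁~u)) u~v = inj₂ (inj₁ (SameSC-trans p₁~u u~v))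
    closed′ (inj₂ (inj₂ (w , on , w~u))) u~v = inj₂ (inj₂ (w , on , SameSC-trans w~u u~v))

    on-ear : Reach EarArc b w → Reach EarArc w y₂ → Y′ w
    on-ear bw wy₂ = inj₂ (inj₂ (_ , (bw , wy₂) , SameSC-refl))

    p₁∈Y′ : Y′ p₁
    p₁∈Y′ = inj₂ (inj₁ SameSC-refl)

    lift : Reach (Induced D Y) ⇒ Reach (Induced D Y′)
    lift = induced-mono inj₁

    within-class : Y′ u → u ~ v → Reach (Induced D Y′) u v
    within-class = walk-in-closed proj₁ closed′

    along-ear : Reach EarArc u v → Reach EarArc b u → Reach EarArc v y₂ → Reach (Induced D Y′) u v
    along-ear {u = u} {v = v} ρ bu vy₂ = map inside (between ρ)
      where
      inside : Between EarArc u v ⇒ Induced D Y′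
      inside (e , us , tv) =
        proj₁ (proj₁ e) , on-ear (bu ◅◅ us) (step e (tv ◅◅ vy₂)) , on-ear (bu ◅◅ us ◅◅ arc e) (tv ◅◅ vy₂)

    y₁⇝a : Reach (Induced D Y′) y₁ a
    y₁⇝a = arc (y₁p₁ , inj₁ y₁∈Y , p₁∈Y′) ◅◅ within-class p₁∈Y′ p₁~a

    a⇝b : Reach (Induced D Y′) a b
    a⇝b = arc (ab , inj₂ (inj₁ p₁~a) , on-ear here σ)

    y₂⇝y₁ : Reach (Induced D Y′) y₂ y₁
    y₂⇝y₁ = lift (strong-in adm y₂∈Y y₁∈Y)

    to-y₁ : Y′ v → Reach (Induced D Y′) v y₁
    to-y₁ (inj₁ yv) = lift (strong-in adm yv y₁∈Y)
    to-y₁ (inj₂ (inj₁ p₁~v)) =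
      within-class (inj₂ (inj₁ p₁~v)) (SameSC-trans (SameSC-sym p₁~v) p₁~a) ◅◅
      a⇝b ◅◅ along-ear σ here here ◅◅ y₂⇝y₁
    to-y₁ (inj₂ (inj₂ z@(u , (bu , uy₂) , u~v))) =
      within-class (inj₂ (inj₂ z)) (SameSC-sym u~v) ◅◅ along-ear uy₂ bu here ◅◅ y₂⇝y₁

    from-y₁ : Y′ v → Reach (Induced D Y′) y₁ v
    from-y₁ (inj₁ yv) = lift (strong-in adm y₁∈Y yv)
    from-y₁ (inj₂ (inj₁ p₁~v)) = arc (y₁p₁ , inj₁ y₁∈Y , p₁∈Y′) ◅◅ within-class p₁∈Y′ p₁~v
    from-y₁ (inj₂ (inj₂ (u , (bu , uy₂) , u~v))) =
      y₁⇝a ◅◅ a⇝b ◅◅ along-ear bu here uy₂ ◅◅ within-class (on-ear bu uy₂) u~v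

    admissible : Admissible Y′
    admissible = record
      { closed = closed′
      ; strong-in = λ yu yv → to-y₁ yu ◅◅ from-y₁ yv
      ; cycle⊆ = inj₁ ∘ cycle⊆ adm
      }

    entering-arc : Y x → D′ x y → p₁ ~ y → x ≡ y₁ × y ≡ p₁
    entering-arc {x = x} {y = y} yx xy p₁~y with x ≟ y₁ ×-dec y ≟ p₁
    ... | yes xy≡y₁p₁ = xy≡y₁p₁
    ... | no xy≢y₁p₁ = contradiction (y₁⇝x ◅◅ step (proj₁ xy , xy≢y₁p₁) y⇝p₁) (no-transitive y₁p₁)
      where
      y₁⇝x : Reach (deleteArc D y₁ p₁) y₁ x
      y₁⇝x = avoiding proj₁ (λ { (_ , _ , yp₁) (refl , refl) → p₁∉Y yp₁ }) (strong-in adm y₁∈Y yx)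
      y⇝p₁ : Reach (deleteArc D y₁ p₁) y p₁
      y⇝p₁ = walk-in-SC-avoiding proj₁ y₁≁p₁ (SameSC-sym p₁~y)

    leaving-arc : p₁ ~ x → D′ x y → ¬ p₁ ~ y → Reach (deleteArc D x y) b y → x ≡ a × y ≡ b
    leaving-arc {x = x} {y = y} p₁~x xy p₁≁y b⇝y with a ≟ x ×-dec b ≟ y
    ... | yes (refl , refl) = refl , refl
    ... | no ab≢xy = contradiction (x⇝a ◅◅ step (ab , ab≢xy) b⇝y) (no-transitive (proj₁ xy))
      where
      x⇝a : Reach (deleteArc D x y) x a
      x⇝a = walk-in-SC-avoiding proj₁ (λ x~y → p₁≁y (SameSC-trans p₁~x x~y))
        (SameSC-trans (SameSC-sym p₁~x) p₁~a)

    ear-avoiding : p₁ ~ x → Reach EarArc ⇒ Reach (deleteArc D x y)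
    ear-avoiding p₁~x = avoiding (proj₁ ∘ proj₁) λ { ((_ , ¬ps) , _) (refl , refl) → ¬ps p₁~x }

    Y-avoiding : p₁ ~ x → Reach (Induced D Y) ⇒ Reach (deleteArc D x y)
    Y-avoiding p₁~x = avoiding proj₁ λ { (_ , ys , _) (refl , refl) → P⊆∁Y p₁~x ys }

    reached-from-b : p₁ ~ x → ¬ p₁ ~ y → Y′ y → Reach (deleteArc D x y) b y
    reached-from-b p₁~x p₁≁y (inj₁ yy) = ear-avoiding p₁~x σ ◅◅ Y-avoiding p₁~x (strong-in adm y₂∈Y yy)
    reached-from-b p₁~x p₁≁y (inj₂ (inj₁ p₁~y)) = contradiction p₁~y p₁≁y
    reached-from-b p₁~x p₁≁y (inj₂ (inj₂ (u , (bu , _) , u~y))) =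
      ear-avoiding p₁~x bu ◅◅ walk-in-SC-avoiding proj₁ (λ x~y → p₁≁y (SameSC-trans p₁~x x~y)) u~y

    in-neighbour : (∀ w → Y′ w) → HArc D′ x p₁ → x ~ y₁
    in-neighbour total (x≁p₁ , x′ , y′ , x~x′ , p₁~y′ , x′y′) with total x′
    ... | inj₁ yx′ with refl , refl ← entering-arc yx′ x′y′ p₁~y′ = x~x′
    ... | inj₂ (inj₁ p₁~x′) = contradiction x~x′ (≁-respʳ x≁p₁ p₁~x′)
    ... | inj₂ (inj₂ zx′) = contradiction (SameSC-trans x~x′ (step x′y′ (proj₂ p₁~y′) , p₁⇝Z zx′)) x≁p₁

    out-neighbour : (∀ w → Y′ w) → HArc D′ p₁ y → y ~ b
    out-neighbour total (p₁≁y , x′ , y′ , p₁~x′ , y~y′ , x′y′)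
      with p₁≁y′ ← ≁-respʳ p₁≁y y~y′
      with refl , refl ← leaving-arc p₁~x′ x′y′ p₁≁y′ (reached-from-b p₁~x′ p₁≁y′ (total y′)) = y~y′

    extension : Extension Y
    extension = record
      { Y′ = Y′
      ; admissible = admissible
      ; Y⊆Y′ = inj₁
      ; new = p₁
      ; new∈Y′ = p₁∈Y′
      ; new∉Y = p₁∉Y
      ; new-linear = λ total →
          single-class (y₁≁p₁ , y₁ , p₁ , SameSC-refl , SameSC-refl , y₁p₁′) (in-neighbour total) ,
          single-class (p₁≁b , a , b , p₁~a , SameSC-refl , ab′) (out-neighbour total)
      }

  extend : Binary.Decidable _~_ → Decidable Y → Admissible Y → ¬ Y w → Extension Y
  extend {w = w} _~?_ Y? adm ¬yw
    with y₁ , p₁ , y₁∈Y , p₁∉Y , y₁p₁ , _ ← last-exit Y? (strong c₀ w) (cycle⊆ adm (zero , refl)) ¬yw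
    with a , b , p₁~a , p₁≁b , ab , τ ← last-exit (p₁ ~?_) (strong p₁ y₁) SameSC-refl
           (λ p₁~y₁ → p₁∉Y (closed adm y₁∈Y (SameSC-sym p₁~y₁)))
    with y₂ , y₂∈Y , σ ← first-entry Y? τ y₁∈Y
    = Ear.extension adm y₁∈Y p₁∉Y y₁p₁ p₁~a p₁≁b ab y₂∈Y σ

  linear-outside : Binary.Decidable _~_ → Decidable Y → Admissible Y → ∃ (∁ Y) →
    ¬ ¬ ∃ λ w → ¬ Y w × Linear D′ w
  linear-outside _~?_ = ⊃-induction Goal λ Y? grow adm (w , ¬yw) → do
    let open Extension (extend _~?_ Y? adm ¬yw)
    Y′? ← ¬¬-decidable Y′
    case all? Y′? of λ where
      (yes total) → pure (new , new∉Y , new-linear total)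
      (no ¬total) → do
        w′ , ¬y′w′ , linear ← grow Y′? Y⊆Y′ (new , new∈Y′ , new∉Y) admissible (¬∀⟶∃¬ _ Y′ Y′? ¬total)
        pure (w′ , ¬y′w′ ∘ Y⊆Y′ , linear)
    where
    Goal : Pred (Fin n) 0ℓ → Set
    Goal Y = Admissible Y → ∃ (∁ Y) → ¬ ¬ ∃ λ w → ¬ Y w × Linear D′ w

  record AnchoredArc : Set where
    field
      tail head : Fin n
      in-D′ : D′ tail head
      separating : ¬ tail ~ head
      anchored : Anchored D′ (suc m) c tail

  open AnchoredArc

  ReachableWithout : AnchoredArc → Pred (Fin n) 0ℓ
  ReachableWithout e = Reach (deleteArc D (tail e) (head e)) c₀

  module Without (e : AnchoredArc) where

    D∖e : Digraph n
    D∖e = deleteArc D (tail e) (head e)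

    R-avoiding : Reach R ⇒ Reach D∖e
    R-avoiding = avoiding R⊆D λ { r (refl , refl) → proj₂ (in-D′ e) r }

    class-avoiding : u ~ v → Reach D∖e u v
    class-avoiding = walk-in-SC-avoiding proj₁ (separating e)

    anchored⊆ : Anchored D′ (suc m) c ⊆ ReachableWithout e
    anchored⊆ (i , u~ci) = R-avoiding (R-strong zero i) ◅◅ class-avoiding (SameSC-sym u~ci)

    tail⇝c₀ : Reach D∖e (tail e) c₀
    tail⇝c₀ = class-avoiding (proj₂ (anchored e)) ◅◅ R-avoiding (R-strong (proj₁ (anchored e)) zero)

    head-unreachable : ¬ ReachableWithout e (head e)
    head-unreachable c₀⇝head = no-transitive (proj₁ (in-D′ e)) (tail⇝c₀ ◅◅ c₀⇝head)

    stays-reachable : ReachableWithout e u → Reach D∖e u v → Reach (Induced D (ReachableWithout e)) u v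
    stays-reachable ru here = here
    stays-reachable ru (step a σ) = step (proj₁ a , ru , ru ◅◅ arc a) (stays-reachable (ru ◅◅ arc a) σ)

    back-to-c₀ : ReachableWithout e u → Reach D u c₀ → Reach (Induced D (ReachableWithout e)) u c₀
    back-to-c₀ ru here = here
    back-to-c₀ {u = u} ru (step {y = t} ut σ) with u ≟ tail e
    ... | yes refl = stays-reachable ru tail⇝c₀
    ... | no u≢tail = step (ut , ru , rt) (back-to-c₀ rt σ)
      where
      rt : ReachableWithout e t
      rt = ru ◅◅ arc (ut , u≢tail ∘ proj₁)

    admissible : Admissible (ReachableWithout e)
    admissible = record
      { closed = λ ru u~v → ru ◅◅ class-avoiding u~v
      ; strong-in = λ {u} ru rv → back-to-c₀ ru (strong u c₀) ◅◅ stays-reachable here rv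
      ; cycle⊆ = λ { (i , refl) → R-avoiding (R-strong zero i) }
      }

  SameArc : AnchoredArc → AnchoredArc → Set
  SameArc e e′ = tail e ≡ tail e′ × head e ≡ head e′

  arc-from-reachable : (e e′ : AnchoredArc) → ¬ SameArc e e′ → ReachableWithout e u → D u t →
    ReachableWithout e t ⊎ ReachableWithout e′ t
  arc-from-reachable {u = u} {t = t} e e′ e≢e′ ru ut with u ≟ tail e ×-dec t ≟ head e
  ... | yes (refl , refl) = inj₂ (Without.anchored⊆ e′ (anchored e) ◅◅ arc (ut , e≢e′))
  ... | no ut≢e = inj₁ (ru ◅◅ arc (ut , ut≢e))

  reachable-without-either : (e e′ : AnchoredArc) → ¬ SameArc e e′ → ∀ w →
    ReachableWithout e w ⊎ ReachableWithout e′ w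
  reachable-without-either e e′ e≢e′ w = go (strong c₀ w) (inj₁ here)
    where
    Either : Pred (Fin n) 0ℓ
    Either = ReachableWithout e ∪ ReachableWithout e′

    go : Reach D u w → Either u → Either w
    go here r = r
    go (step ut σ) (inj₁ ru) = go σ (arc-from-reachable e e′ e≢e′ ru ut)
    go (step ut σ) (inj₂ ru) = go σ (Sum.swap (arc-from-reachable e′ e e′≢e ru ut))
      where
      e′≢e : ¬ SameArc e′ e
      e′≢e (p , q) = e≢e′ (sym p , sym q)

  same-tail : (e e′ : AnchoredArc) → ¬ ReachableWithout e w → ¬ ReachableWithout e′ v → w ~ v →
    tail e ≡ tail e′
  same-tail {w = w} e e′ ¬rw ¬r′v w~v with tail e ≟ tail e′ ×-dec head e ≟ head e′
  ... | yes (tails≡ , _) = tails≡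
  ... | no e≢e′ with reachable-without-either e e′ e≢e′ w
  ...   | inj₁ rw = contradiction rw ¬rw
  ...   | inj₂ r′w = contradiction (Admissible.closed (Without.admissible e′) r′w w~v) ¬r′v

  linear-beyond : (e : AnchoredArc) → ¬ ¬ ∃ λ w → ¬ ReachableWithout e w × Linear D′ w
  linear-beyond e = do
    _~?_ ← ¬¬-∀-Fin λ x → ¬¬-decidable (x ~_)
    R? ← ¬¬-decidable (ReachableWithout e)
    linear-outside _~?_ R? (Without.admissible e) (head e , Without.head-unreachable e)

  anchored-arc : PseudoMinimal D′ (suc m) c r → Σ AnchoredArc λ e → r ~ tail e
  anchored-arc ((i , r~ci) , y , r≁y , x′ , y′ , r~x′ , y~y′ , x′y′) = record
    { tail = x′
    ; head = y′
    ; in-D′ = x′y′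
    ; separating = λ x′~y′ → r≁y (SameSC-trans r~x′ (SameSC-trans x′~y′ (SameSC-sym y~y′)))
    ; anchored = i , SameSC-trans (SameSC-sym r~x′) r~ci
    } , r~x′

  pseudominimal≤linear : ∀ {kLin kMin} →
    NumClasses _~_ (Linear D′) kLin → NumClasses _~_ (PseudoMinimal D′ (suc m) c) kMin → kMin ≤ kLin
  pseudominimal≤linear {kLin} {kMin} (rL , _ , _ , coverL) (rM , pseudominimal , distinctM , _) =
    decidable-stable (kMin ≤? kLin) do
      F ← ¬¬-∀-Fin (linear-beyond ∘ e)
      pure (injective⇒≤ (class-injective F))
    where
    e : Fin kMin → AnchoredArc
    e i = proj₁ (anchored-arc (pseudominimal i))

    Beyond : Fin kMin → Set
    Beyond i = ∃ λ w → ¬ ReachableWithout (e i) w × Linear D′ w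

    class : (∀ i → Beyond i) → Fin kMin → Fin kLin
    class F i = proj₁ (coverL (proj₁ (F i)) (proj₂ (proj₂ (F i))))

    in-class : (F : ∀ i → Beyond i) → ∀ i → proj₁ (F i) ~ rL (class F i)
    in-class F i = proj₂ (coverL (proj₁ (F i)) (proj₂ (proj₂ (F i))))

    class-injective : (F : ∀ i → Beyond i) → ∀ {i i′} → class F i ≡ class F i′ → i ≡ i′
    class-injective F {i} {i′} classes≡ = distinctM i i′
      (SameSC-trans (proj₂ (anchored-arc (pseudominimal i)))
        (subst (_~ rM i′) (sym tails≡) (SameSC-sym (proj₂ (anchored-arc (pseudominimal i′))))))
      where
      tails≡ : tail (e i) ≡ tail (e i′)
      tails≡ = same-tail (e i) (e i′) (proj₁ (proj₂ (F i))) (proj₁ (proj₂ (F i′)))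
        (SameSC-trans (in-class F i)
          (subst (λ j → rL j ~ proj₁ (F i′)) (sym classes≡) (SameSC-sym (in-class F i′))))

theorem2 : ∀ {n} (D : Digraph n) → Loopless D → MinimalStrong D →
    (q : ℕ) → 2 ≤ q → (c : Fin q → Fin n) → IsCycle D q c →
    (kLin kMin kMax : ℕ) →
    NumClasses (SameSC (deleteCycle D q c)) (Linear (deleteCycle D q c)) kLin →
    NumClasses (SameSC (deleteCycle D q c)) (PseudoMinimal (deleteCycle D q c) q c) kMin →
    NumClasses (SameSC (deleteCycle D q c)) (PseudoMaximal (deleteCycle D q c) q c) kMax →
    kMin ≤ kLin × kMax ≤ kLin
theorem2 D _ minimal (suc m) _ c cycle kLin kMin kMax linear pseudominimal pseudomaximal =
  Forward.pseudominimal≤linear linear pseudominimal ,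
  Backward.pseudominimal≤linear
    (NumClasses-resp {E = SameSC Forward.D′} SameSC-flip SameSC-flip Linear-flip Linear-flip linear)
    (NumClasses-resp {E = SameSC Forward.D′} SameSC-flip SameSC-flip
      PseudoMaximal-flip PseudoMinimal-flip pseudomaximal)
  where
  module Forward = CycleDeletion D (CycleArc _ c) minimal
    (CycleArc⊆ cycle) c CycleArc-ends (CycleArc-strong c)
  module Backward = CycleDeletion (flip D) (flip (CycleArc _ c)) (MinimalStrong-flip minimal)
    (CycleArc⊆ cycle) c (swap ∘ CycleArc-ends) (λ i j → reverse (CycleArc-strong c j i))
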